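{- For all integers $n,k$ with $6\leq n\leq k$, $\chi_\delta(P_n\square P_k)=\left\lceil\frac{(n-2)(k-2)}{2}\right\rceil$.
   Context: All graphs are finite and simple; $P_n$ is the path on $n$ vertices; $d_G(x)$ denotes the degree of $x$ in $G$. The $\delta$-complement $G_\delta$ of a graph $G$ is the graph on $V(G)$ in which distinct $u,v$ are adjacent iff either ($d_G(u)=d_G(v)$ and $uv\notin E(G)$) or ($d_G(u)\neq d_G(v)$ and $uv\in E(G)$). The $\delta$-chromatic number $\chi_\delta(G)$ is the chromatic number of $G_\delta$. The Cartesian product $G\square H$ has vertex set $V(G)\times V(H)$, with $(x,y)$ adjacent to $(x',y')$ iff either $x=x'$ and $yy'\in E(H)$, or $y=y'$ and $xx'\in E(G)$. -}

module Defs where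

open import Data.Nat using (ℕ; zero; suc; _≤_; _≡ᵇ_; _∸_)
open import Data.Bool using (Bool; true; false; if_then_else_; not; _∧_; _∨_)
open import Data.Fin using (Fin; toℕ; remQuot)
open import Data.Fin.Properties using (_≟_)
open import Data.List using (List; allFin; map)
open import Data.Nat.ListAction using (sum)
open import Data.Product using (_×_; _,_; Σ)
open import Relation.Binary.PropositionalEquality using (_≡_; _≢_)
open import Relation.Nullary using (does)

-- A finite simple graph on the vertex set Fin N, given by a Boolean
-- adjacency function (intended symmetric and irreflexive).
Graph : ℕ → Set
Graph N = Fin N → Fin N → Bool

deg : ∀ {N} → Graph N → Fin N → ℕ
deg {N} G x = sum (map (λ y → if G x y then 1 else 0) (allFin N))

dist1 : ℕ → ℕ → Bool
dist1 a b = (suc a ≡ᵇ b) ∨ (suc b ≡ᵇ a)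

P : (n : ℕ) → Graph n
P n i j = dist1 (toℕ i) (toℕ j)

_□_ : ∀ {m n} → Graph m → Graph n → Graph (m Data.Nat.* n)
_□_ {m} {n} G H u v with remQuot {m} n u | remQuot {m} n v
... | (x , y) | (x' , y') =
  (does (x ≟ x') ∧ H y y') ∨ (does (y ≟ y') ∧ G x x')

δ-complement : ∀ {N} → Graph N → Graph N
δ-complement G u v =
  if does (u ≟ v) then false
  else (if deg G u ≡ᵇ deg G v then not (G u v) else G u v)

Colorable : ∀ {N} → Graph N → ℕ → Set
Colorable {N} G c =
  Σ (Fin N → Fin c) λ f → ∀ u v → G u v ≡ true → f u ≢ f v

IsChromaticNumber : ∀ {N} → Graph N → ℕ → Set
IsChromaticNumber G m = Colorable G m × (∀ c → Colorable G c → m ≤ c)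

IsδChromaticNumber : ∀ {N} → Graph N → ℕ → Set
IsδChromaticNumber G m = IsChromaticNumber (δ-complement G) m

-- In the δ-complement two vertices of equal degree are adjacent iff they are not
-- adjacent in G, and two vertices of different degree iff they are. So in a proper colouring of
-- G_δ the vertices of one colour and one degree form a clique of G, and there is no edge of G
-- between the degree classes of a colour.
--
-- Lower bound: the (n-2)(k-2) inner vertices of P_n □ P_k all have degree 4, and a clique of the
-- bipartite grid has at most two vertices, so each colour is used on at most two of them.
--
-- Upper bound: pair the inner vertices into dominoes of adjacent vertices (vertical ones, and
-- horizontal ones in the last inner row when n is odd), one colour per domino, and give each
-- boundary domino of degree-3 vertices and each corner the colour of a distant inner domino.

module Submission where

open import Defs
open import Data.Bool using (Bool; true; false; T; if_then_else_; not; _∧_; _∨_)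
open import Data.Bool.Properties using (∧-comm; ∧-zeroʳ; ∨-comm; ∨-zeroʳ; T-≡; T-∧; T-∨)
open import Data.Empty using (⊥; ⊥-elim)
import Data.Fin as Fin
open import Data.Fin using (Fin; zero; suc; toℕ; fromℕ<; combine; remQuot; inject₁; _↑ˡ_; _↑ʳ_)
open import Data.Fin.Properties
  using (_≟_; _<?_; <-cmp; <⇒≢; any?; remQuot-combine; combine-remQuot; combine-injective; toℕ<n;
         toℕ-injective; toℕ-fromℕ<; toℕ-inject₁; inject₁-injective; suc-injective; injective⇒≤)
  renaming (<-trans to <-transFin)
open import Data.List using () renaming (tabulate to tabulateList)
open import Data.List.Properties using (map-tabulate)
open import Data.Nat using (ℕ; zero; suc; pred; _+_; _*_; _∸_; _%_; _≤_; _<_; z≤n; s≤s; _≡ᵇ_; _<ᵇ_;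
                            ⌊_/2⌋; ⌈_/2⌉; parity; NonZero)
open import Data.Nat.DivMod using ([m+kn]%n≡m%n; m<n⇒m%n≡m)
open import Data.Nat.ListAction using () renaming (sum to sumList)
open import Data.Nat.Properties
  using (+-assoc; +-comm; +-identityʳ; +-suc; *-comm; *-identityˡ; +-cancelʳ-≡; *-cancelʳ-≡; ≡ᵇ⇒≡; <ᵇ⇒<; <⇒<ᵇ;
         ≤-refl; ≤-trans; ≤-antisym; ≤-pred; <-irrefl; <-≤-trans; ≤-<-trans; ≤∧≢⇒<; ≮⇒≥; >⇒≢; n≤1+n;
         m<n⇒m<1+n; m≤n+m; +-monoʳ-≤; +-monoʳ-<; *-monoˡ-≤; *-distribʳ-+; ⌊n/2⌋-mono; ⌈n/2⌉-mono;
         ⌊n/2⌋≤n; ⌊n/2⌋≤⌈n/2⌉; ⌊n/2⌋+⌈n/2⌉≡n; n≡⌈n+n/2⌉; n≡⌊n+n/2⌋; module ≤-Reasoning;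
         +-commutativeSemigroup; +-*-semiring)
  renaming (_≟_ to _≟ℕ_; _<?_ to _<ℕ?_)
open import Algebra.Properties.CommutativeSemigroup +-commutativeSemigroup using (interchange)
open import Algebra.Properties.Semiring.Sum +-*-semiring
  using (sum; sum-syntax; sum-cong-≗; ∑-distrib-+; *-distribˡ-sum; sum-replicate-zero)
open import Data.Parity using (Parity; _⁻¹)
open import Data.Parity.Properties using (suc-homo-⁻¹; ⁻¹-involutive; ⁻¹-injective; p≢p⁻¹)
open import Data.Product using (_×_; _,_; _,′_; proj₁; proj₂; ∃)
open import Data.Sum using (_⊎_; inj₁; inj₂)
open import Function using (_∘_; id)
open import Function.Bundles using (Equivalence)
open import Relation.Binary.Definitions using (tri<; tri≈; tri>)
open import Relation.Binary.PropositionalEquality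
open import Relation.Nullary using (Dec; does; yes; no; ¬_)
open import Relation.Nullary.Decidable using (_×-dec_; dec-true)

indicator : Bool → ℕ
indicator b = if b then 1 else 0

indicator-T : ∀ {b} → T b → indicator b ≡ 1
indicator-T {true} _ = refl

indicator-¬T : ∀ {b} → ¬ T b → indicator b ≡ 0
indicator-¬T {true}  ¬t = ⊥-elim (¬t _)
indicator-¬T {false} _  = refl

indicator-∨ : ∀ p q → (p ≡ true → q ≡ false) → indicator (p ∨ q) ≡ indicator p + indicator q
indicator-∨ true  q disjoint rewrite disjoint refl = refl
indicator-∨ false q disjoint = refl

indicator-∧ : ∀ p q → indicator (p ∧ q) ≡ indicator p * indicator q
indicator-∧ true  true  = refl
indicator-∧ true  false = refl
indicator-∧ false q     = refl

sum-tabulate : ∀ n (f : Fin n → ℕ) → sumList (tabulateList f) ≡ ∑[ i < n ] f i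
sum-tabulate zero    f = refl
sum-tabulate (suc n) f = cong (f zero +_) (sum-tabulate n (f ∘ suc))

deg-∑ : ∀ {N} (G : Graph N) x → deg G x ≡ ∑[ y < N ] indicator (G x y)
deg-∑ {N} G x =
  trans (cong sumList (map-tabulate id (indicator ∘ G x))) (sum-tabulate N (indicator ∘ G x))

∑-↑ : ∀ p q (h : Fin (p + q) → ℕ) →
      sum h ≡ ∑[ i < p ] h (i ↑ˡ q) + ∑[ j < q ] h (p ↑ʳ j)
∑-↑ zero    q h = refl
∑-↑ (suc p) q h = trans (cong (h zero +_) (∑-↑ p q (h ∘ suc))) (sym (+-assoc (h zero) _ _))

∑-combine : ∀ m n (h : Fin (m * n) → ℕ) → sum h ≡ ∑[ i < m ] ∑[ j < n ] h (combine i j)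
∑-combine zero    n h = refl
∑-combine (suc m) n h =
  trans (∑-↑ n (m * n) h) (cong (∑[ j < n ] h (j ↑ˡ (m * n)) +_) (∑-combine m n (h ∘ (n ↑ʳ_))))

∑-select : ∀ {n} (i : Fin n) (g : Fin n → ℕ) → ∑[ j < n ] (indicator (does (i ≟ j)) * g j) ≡ g i
∑-select {suc n} zero    g =
  trans (cong₂ _+_ (*-identityˡ (g zero)) (sum-replicate-zero n)) (+-identityʳ (g zero))
∑-select {suc n} (suc i) g = ∑-select i (g ∘ suc)

∑-count : ∀ n c → ∑[ j < n ] indicator (c ≡ᵇ toℕ j) ≡ indicator (c <ᵇ n)
∑-count zero    c       = refl
∑-count (suc n) zero    = cong suc (sum-replicate-zero n)
∑-count (suc n) (suc c) = ∑-count n c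

∑-count′ : ∀ n c → ∑[ j < n ] indicator (toℕ j ≡ᵇ c) ≡ indicator (c <ᵇ n)
∑-count′ zero    c       = refl
∑-count′ (suc n) zero    = cong suc (sum-replicate-zero n)
∑-count′ (suc n) (suc c) = ∑-count′ n c

□-edge : ∀ {m n} → Graph m → Graph n → Fin m × Fin n → Fin m × Fin n → Bool
□-edge G H (x , y) (x' , y') = (does (x ≟ x') ∧ H y y') ∨ (does (y ≟ y') ∧ G x x')

□-remQuot : ∀ {m n} (G : Graph m) (H : Graph n) u v →
            (G □ H) u v ≡ □-edge G H (remQuot {m} n u) (remQuot {m} n v)
□-remQuot {m} {n} G H u v with remQuot {m} n u | remQuot {m} n v
... | _ , _ | _ , _ = refl

□-combine : ∀ {m n} (G : Graph m) (H : Graph n) x y x' y' →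
            (G □ H) (combine x y) (combine x' y') ≡ (does (x ≟ x') ∧ H y y') ∨ (does (y ≟ y') ∧ G x x')
□-combine {m} {n} G H x y x' y' =
  trans (□-remQuot G H (combine x y) (combine x' y'))
        (cong₂ (□-edge G H) (remQuot-combine {m} {n} x y) (remQuot-combine {m} {n} x' y'))

□-indicator : ∀ {m n} (G : Graph m) (H : Graph n) → (∀ x → G x x ≡ false) → ∀ x y x' y' →
              indicator ((G □ H) (combine x y) (combine x' y')) ≡
              indicator (does (x ≟ x')) * indicator (H y y') + indicator (does (y ≟ y')) * indicator (G x x')
□-indicator G H irrefl x y x' y' rewrite □-combine G H x y x' y' with x ≟ x'
... | no _ = indicator-∧ (does (y ≟ y')) (G x x')
... | yes refl rewrite irrefl x with H y y' | does (y ≟ y')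
...   | true  | true  = refl
...   | true  | false = refl
...   | false | true  = refl
...   | false | false = refl

deg-□ : ∀ {m n} (G : Graph m) (H : Graph n) → (∀ x → G x x ≡ false) →
        ∀ x y → deg (G □ H) (combine x y) ≡ deg H y + deg G x
deg-□ {m} {n} G H irrefl x y = begin
  deg (G □ H) (combine x y)
    ≡⟨ deg-∑ (G □ H) (combine x y) ⟩
  ∑[ w < m * n ] indicator ((G □ H) (combine x y) w)
    ≡⟨ ∑-combine m n _ ⟩
  ∑[ x' < m ] ∑[ y' < n ] indicator ((G □ H) (combine x y) (combine x' y'))
    ≡⟨ sum-cong-≗ (λ x' → sum-cong-≗ (□-indicator G H irrefl x y x')) ⟩
  ∑[ x' < m ] ∑[ y' < n ] (indicator (does (x ≟ x')) * indicator (H y y')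
                          + indicator (does (y ≟ y')) * indicator (G x x'))
    ≡⟨ sum-cong-≗ (λ x' → trans (∑-distrib-+ (λ y' → indicator (does (x ≟ x')) * indicator (H y y'))
                                             (λ y' → indicator (does (y ≟ y')) * indicator (G x x')))
                                (cong₂ _+_ (sym (*-distribˡ-sum (indicator (does (x ≟ x'))) (indicator ∘ H y)))
                                           (∑-select y (λ _ → indicator (G x x'))))) ⟩
  ∑[ x' < m ] (indicator (does (x ≟ x')) * ∑[ y' < n ] indicator (H y y') + indicator (G x x'))
    ≡⟨ ∑-distrib-+ (λ x' → indicator (does (x ≟ x')) * ∑[ y' < n ] indicator (H y y')) (indicator ∘ G x) ⟩
  ∑[ x' < m ] (indicator (does (x ≟ x')) * ∑[ y' < n ] indicator (H y y')) + ∑[ x' < m ] indicator (G x x')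
    ≡⟨ cong₂ _+_ (trans (∑-select x (λ _ → ∑[ y' < n ] indicator (H y y'))) (sym (deg-∑ H y)))
                 (sym (deg-∑ G x)) ⟩
  deg H y + deg G x
    ∎
  where open ≡-Reasoning

dist1-irrefl : ∀ x → dist1 x x ≡ false
dist1-irrefl zero    = refl
dist1-irrefl (suc x) = dist1-irrefl x

steps-disjoint : ∀ x y → (suc x ≡ᵇ y) ≡ true → (suc y ≡ᵇ x) ≡ false
steps-disjoint zero    (suc y) _ = refl
steps-disjoint (suc x) (suc y) e = steps-disjoint x y e

pathDegree : ℕ → ℕ → ℕ
pathDegree n x = indicator (suc x <ᵇ n) + indicator (0 <ᵇ x)

∑-predecessor : ∀ {n} (x : Fin n) → ∑[ j < n ] indicator (suc (toℕ j) ≡ᵇ toℕ x) ≡ indicator (0 <ᵇ toℕ x)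
∑-predecessor {n}     zero    = sum-replicate-zero n
∑-predecessor {suc n} (suc x) =
  trans (∑-count′ (suc n) (toℕ x)) (indicator-T (<⇒<ᵇ (m<n⇒m<1+n (toℕ<n x))))

deg-P : ∀ n (x : Fin n) → deg (P n) x ≡ pathDegree n (toℕ x)
deg-P n x = begin
  deg (P n) x
    ≡⟨ deg-∑ (P n) x ⟩
  ∑[ j < n ] indicator (dist1 (toℕ x) (toℕ j))
    ≡⟨ sum-cong-≗ {n} (λ j → indicator-∨ _ _ (steps-disjoint (toℕ x) (toℕ j))) ⟩
  ∑[ j < n ] (indicator (suc (toℕ x) ≡ᵇ toℕ j) + indicator (suc (toℕ j) ≡ᵇ toℕ x))
    ≡⟨ ∑-distrib-+ {n} (λ j → indicator (suc (toℕ x) ≡ᵇ toℕ j))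
                       (λ j → indicator (suc (toℕ j) ≡ᵇ toℕ x)) ⟩
  ∑[ j < n ] indicator (suc (toℕ x) ≡ᵇ toℕ j) + ∑[ j < n ] indicator (suc (toℕ j) ≡ᵇ toℕ x)
    ≡⟨ cong₂ _+_ (∑-count n (suc (toℕ x))) (∑-predecessor x) ⟩
  pathDegree n (toℕ x)
    ∎
  where open ≡-Reasoning

pathDegree-end : ∀ m → pathDegree (suc (suc m)) (suc m) ≡ 1
pathDegree-end m = cong (_+ 1) (indicator-¬T (<-irrefl refl ∘ <ᵇ⇒< m m))

pathDegree-inner : ∀ {m t} → t < m → pathDegree (suc (suc m)) (suc t) ≡ 2
pathDegree-inner t<m = cong (_+ 1) (indicator-T (<⇒<ᵇ t<m))

≡ᵇ-refl : ∀ m → (m ≡ᵇ m) ≡ true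
≡ᵇ-refl zero    = refl
≡ᵇ-refl (suc m) = ≡ᵇ-refl m

≡ᵇ-sym : ∀ m n → (m ≡ᵇ n) ≡ (n ≡ᵇ m)
≡ᵇ-sym zero    zero    = refl
≡ᵇ-sym zero    (suc n) = refl
≡ᵇ-sym (suc m) zero    = refl
≡ᵇ-sym (suc m) (suc n) = ≡ᵇ-sym m n

≢⇒≡ᵇ-false : ∀ {m n} → m ≢ n → (m ≡ᵇ n) ≡ false
≢⇒≡ᵇ-false {zero}  {zero}  m≢n = ⊥-elim (m≢n refl)
≢⇒≡ᵇ-false {zero}  {suc n} _   = refl
≢⇒≡ᵇ-false {suc m} {zero}  _   = refl
≢⇒≡ᵇ-false {suc m} {suc n} m≢n = ≢⇒≡ᵇ-false (m≢n ∘ cong suc)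

≡ᵇ-+2 : ∀ m → (suc (suc m) ≡ᵇ m) ≡ false
≡ᵇ-+2 zero    = refl
≡ᵇ-+2 (suc m) = ≡ᵇ-+2 m

dist1-sym : ∀ m n → dist1 m n ≡ dist1 n m
dist1-sym m n = ∨-comm (suc m ≡ᵇ n) (suc n ≡ᵇ m)

dist1-+2 : ∀ m → dist1 (suc (suc m)) m ≡ false
dist1-+2 zero    = refl
dist1-+2 (suc m) = dist1-+2 m

⌊/2⌋-≡⇒dist1 : ∀ t t' → ⌊ t /2⌋ ≡ ⌊ t' /2⌋ → t ≢ t' → dist1 t t' ≡ true
⌊/2⌋-≡⇒dist1 zero          zero           _ t≢t' = ⊥-elim (t≢t' refl)
⌊/2⌋-≡⇒dist1 zero          (suc zero)     _ _    = refl
⌊/2⌋-≡⇒dist1 zero          (suc (suc _))  () _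
⌊/2⌋-≡⇒dist1 (suc zero)    zero           _ _    = refl
⌊/2⌋-≡⇒dist1 (suc zero)    (suc zero)     _ t≢t' = ⊥-elim (t≢t' refl)
⌊/2⌋-≡⇒dist1 (suc zero)    (suc (suc _))  () _
⌊/2⌋-≡⇒dist1 (suc (suc _)) zero           () _
⌊/2⌋-≡⇒dist1 (suc (suc _)) (suc zero)     () _
⌊/2⌋-≡⇒dist1 (suc (suc t)) (suc (suc t')) e  t≢t' =
  ⌊/2⌋-≡⇒dist1 t t' (cong pred e) (t≢t' ∘ cong (λ m → suc (suc m)))

gridAdj : ℕ → ℕ → ℕ → ℕ → Bool
gridAdj x y x' y' = ((x ≡ᵇ x') ∧ dist1 y y') ∨ (dist1 x x' ∧ (y ≡ᵇ y'))

does-≟-toℕ : ∀ {n} (i j : Fin n) → does (i ≟ j) ≡ (toℕ i ≡ᵇ toℕ j)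
does-≟-toℕ zero    zero    = refl
does-≟-toℕ zero    (suc j) = refl
does-≟-toℕ (suc i) zero    = refl
does-≟-toℕ (suc i) (suc j) = does-≟-toℕ i j

grid-combine : ∀ {n k} (x x' : Fin n) (y y' : Fin k) →
               (P n □ P k) (combine x y) (combine x' y') ≡ gridAdj (toℕ x) (toℕ y) (toℕ x') (toℕ y')
grid-combine {n} {k} x x' y y' = begin
  (P n □ P k) (combine x y) (combine x' y')
    ≡⟨ □-combine (P n) (P k) x y x' y' ⟩
  (does (x ≟ x') ∧ P k y y') ∨ (does (y ≟ y') ∧ P n x x')
    ≡⟨ cong₂ (λ p q → (p ∧ P k y y') ∨ q) (does-≟-toℕ x x')
             (trans (cong (_∧ P n x x') (does-≟-toℕ y y')) (∧-comm (toℕ y ≡ᵇ toℕ y') (P n x x'))) ⟩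
  gridAdj (toℕ x) (toℕ y) (toℕ x') (toℕ y')
    ∎
  where open ≡-Reasoning

grid-deg-combine : ∀ {n k} (x : Fin n) (y : Fin k) →
                   deg (P n □ P k) (combine x y) ≡ pathDegree k (toℕ y) + pathDegree n (toℕ x)
grid-deg-combine {n} {k} x y =
  trans (deg-□ (P n) (P k) (dist1-irrefl ∘ toℕ) x y) (cong₂ _+_ (deg-P k y) (deg-P n x))

gridAdj-sym : ∀ x y x' y' → gridAdj x y x' y' ≡ gridAdj x' y' x y
gridAdj-sym x y x' y' =
  cong₂ _∨_ (cong₂ _∧_ (≡ᵇ-sym x x') (dist1-sym y y')) (cong₂ _∧_ (dist1-sym x x') (≡ᵇ-sym y y'))

gridAdj-row : ∀ x y y' → dist1 y y' ≡ true → gridAdj x y x y' ≡ true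
gridAdj-row x _ _ step rewrite ≡ᵇ-refl x | step = refl

gridAdj-column : ∀ x x' y → dist1 x x' ≡ true → gridAdj x y x' y ≡ true
gridAdj-column x x' y step rewrite step | ≡ᵇ-refl y = ∨-zeroʳ ((x ≡ᵇ x') ∧ dist1 y y)

gridAdj-false : ∀ x y x' y' → (x ≡ᵇ x') ≡ false ⊎ dist1 y y' ≡ false →
                dist1 x x' ≡ false ⊎ (y ≡ᵇ y') ≡ false →
                gridAdj x y x' y' ≡ false
gridAdj-false _ _ _ _ no-row-step no-column-step = cong₂ _∨_ (∧-false no-row-step) (∧-false no-column-step)
  where
  ∧-false : ∀ {p q} → p ≡ false ⊎ q ≡ false → (p ∧ q) ≡ false
  ∧-false {p} (inj₁ refl) = refl
  ∧-false {p} (inj₂ refl) = ∧-zeroʳ p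

gridAdj⇒sums-consecutive : ∀ x y x' y' → gridAdj x y x' y' ≡ true →
                           x' + y' ≡ suc (x + y) ⊎ x + y ≡ suc (x' + y')
gridAdj⇒sums-consecutive x y x' y' adj with Equivalence.to T-∨ (Equivalence.from T-≡ adj)
... | inj₁ same-row with Equivalence.to T-∧ same-row
...   | x≡x' , step with ≡ᵇ⇒≡ x x' x≡x' | Equivalence.to T-∨ step
...     | refl | inj₁ right = inj₁ (trans (cong (x +_) (sym (≡ᵇ⇒≡ (suc y) y' right))) (+-suc x y))
...     | refl | inj₂ left  = inj₂ (trans (cong (x +_) (sym (≡ᵇ⇒≡ (suc y') y left))) (+-suc x y'))
gridAdj⇒sums-consecutive x y x' y' adj | inj₂ same-column with Equivalence.to T-∧ same-column
...   | step , y≡y' with ≡ᵇ⇒≡ y y' y≡y' | Equivalence.to T-∨ step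
...     | refl | inj₁ down = inj₁ (cong (_+ y) (sym (≡ᵇ⇒≡ (suc x) x' down)))
...     | refl | inj₂ up   = inj₂ (cong (_+ y) (sym (≡ᵇ⇒≡ (suc x') x up)))

parity-suc : ∀ n → parity (suc n) ≡ parity n ⁻¹
parity-suc n = trans (sym (⁻¹-involutive (parity (suc n)))) (cong _⁻¹ (suc-homo-⁻¹ n))

gridAdj⇒opposite-parity : ∀ x y x' y' → gridAdj x y x' y' ≡ true → parity (x + y) ≡ parity (x' + y') ⁻¹
gridAdj⇒opposite-parity x y x' y' adj with gridAdj⇒sums-consecutive x y x' y' adj
... | inj₁ e rewrite e = sym (trans (cong _⁻¹ (parity-suc (x + y))) (⁻¹-involutive _))
... | inj₂ e rewrite e = parity-suc (x' + y')

module GridCoordinates (n k : ℕ) where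

  row col : Fin (n * k) → ℕ
  row u = toℕ (proj₁ (remQuot {n} k u))
  col u = toℕ (proj₂ (remQuot {n} k u))

  grid-adj : ∀ u v → (P n □ P k) u v ≡ gridAdj (row u) (col u) (row v) (col v)
  grid-adj u v = trans (cong₂ (P n □ P k) (sym (combine-remQuot {n} k u)) (sym (combine-remQuot {n} k v)))
                       (grid-combine (proj₁ (remQuot {n} k u)) (proj₁ (remQuot {n} k v))
                                     (proj₂ (remQuot {n} k u)) (proj₂ (remQuot {n} k v)))

  coordinates-injective : ∀ {u v} → (row u , col u) ≡ (row v , col v) → u ≡ v
  coordinates-injective {u} {v} same = begin
    u
      ≡⟨ combine-remQuot {n} k u ⟨
    combine (proj₁ (remQuot {n} k u)) (proj₂ (remQuot {n} k u))
      ≡⟨ cong₂ combine (toℕ-injective (cong proj₁ same)) (toℕ-injective (cong proj₂ same)) ⟩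
    combine (proj₁ (remQuot {n} k v)) (proj₂ (remQuot {n} k v))
      ≡⟨ combine-remQuot {n} k v ⟩
    v
      ∎
    where open ≡-Reasoning

  grid-deg : ∀ u → deg (P n □ P k) u ≡ pathDegree k (col u) + pathDegree n (row u)
  grid-deg u = trans (cong (deg (P n □ P k)) (sym (combine-remQuot {n} k u)))
                     (grid-deg-combine (proj₁ (remQuot {n} k u)) (proj₂ (remQuot {n} k u)))

δ-edge : ℕ → ℕ → Bool → Bool
δ-edge d d' g = if d ≡ᵇ d' then not g else g

δ-edge-same : ∀ d g → δ-edge d d g ≡ not g
δ-edge-same zero    g = refl
δ-edge-same (suc d) g = δ-edge-same d g

δ-edge-sym : ∀ d d' g → δ-edge d d' g ≡ δ-edge d' d g
δ-edge-sym d d' g = cong (λ same → if same then not g else g) (≡ᵇ-sym d d')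

δ-complement-≢ : ∀ {N} (G : Graph N) {u v} → u ≢ v → δ-complement G u v ≡ δ-edge (deg G u) (deg G v) (G u v)
δ-complement-≢ G {u} {v} u≢v with u ≟ v
... | yes u≡v = ⊥-elim (u≢v u≡v)
... | no  _   = refl

δ-complement-irrefl : ∀ {N} (G : Graph N) u → δ-complement G u u ≡ false
δ-complement-irrefl G u =
  cong (λ same → if same then false else δ-edge (deg G u) (deg G u) (G u u)) (dec-true (u ≟ u) refl)

monochromatic⇒adjacent : ∀ {N c} (G : Graph N) (f : Fin N → Fin c) →
                         (∀ u v → δ-complement G u v ≡ true → f u ≢ f v) →
                         ∀ {u v} → u ≢ v → deg G u ≡ deg G v → f u ≡ f v → G u v ≡ true
monochromatic⇒adjacent G f proper {u} {v} u≢v same-deg fu≡fv with G u v in uv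
... | true  = refl
... | false = ⊥-elim (proper u v δuv fu≡fv)
  where
  δuv : δ-complement G u v ≡ true
  δuv = begin
    δ-complement G u v                      ≡⟨ δ-complement-≢ G u≢v ⟩
    δ-edge (deg G u) (deg G v) (G u v)      ≡⟨ cong₂ (δ-edge (deg G u)) (sym same-deg) uv ⟩
    δ-edge (deg G u) (deg G u) false        ≡⟨ δ-edge-same (deg G u) false ⟩
    true                                    ∎
    where open ≡-Reasoning

-- Lower bound

-- Each vertex records whether an earlier vertex has its colour; with at most two vertices
-- per colour, (colour, record) is then injective.
noMonochromaticTriple⇒≤*2 : ∀ {N c} (f : Fin N → Fin c) →
  (∀ {u v w} → u Fin.< v → v Fin.< w → f u ≡ f v → f v ≡ f w → ⊥) → N ≤ c * 2
noMonochromaticTriple⇒≤*2 {N} {c} f no-triple = injective⇒≤ {f = tag} tag-injective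
  where
  EarlierTwin : Fin N → Fin N → Set
  EarlierTwin w w' = w' Fin.< w × f w' ≡ f w

  hasEarlierTwin : ∀ w → Dec (∃ (EarlierTwin w))
  hasEarlierTwin w = any? (λ w' → (w' <? w) ×-dec (f w' ≟ f w))

  bit : Bool → Fin 2
  bit b = if b then suc zero else zero

  tag : Fin N → Fin (c * 2)
  tag w = combine (f w) (bit (does (hasEarlierTwin w)))

  same-tag⇒⊥ : ∀ {v w} → v Fin.< w → f v ≡ f w →
               (dv : Dec (∃ (EarlierTwin v))) (dw : Dec (∃ (EarlierTwin w))) →
               bit (does dv) ≡ bit (does dw) → ⊥
  same-tag⇒⊥ v<w fv≡fw _                        (no ¬twin) _  = ¬twin (_ , v<w , fv≡fw)
  same-tag⇒⊥ v<w fv≡fw (yes (u , u<v , fu≡fv)) (yes _)    _  = no-triple u<v v<w fu≡fv fv≡fw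
  same-tag⇒⊥ v<w fv≡fw (no _)                  (yes _)    ()

  tag-injective : ∀ {v w} → tag v ≡ tag w → v ≡ w
  tag-injective {v} {w} eq with combine-injective (f v) _ (f w) _ eq | <-cmp v w
  ... | _     , _    | tri≈ _ v≡w _ = v≡w
  ... | fv≡fw , bits | tri< v<w _ _ = ⊥-elim (same-tag⇒⊥ v<w fv≡fw (hasEarlierTwin v) (hasEarlierTwin w) bits)
  ... | fv≡fw , bits | tri> _ _ w<v =
    ⊥-elim (same-tag⇒⊥ w<v (sym fv≡fw) (hasEarlierTwin w) (hasEarlierTwin v) (sym bits))

⌈/2⌉-≤ : ∀ {m c} → m ≤ c * 2 → ⌈ m /2⌉ ≤ c
⌈/2⌉-≤ {m} {c} m≤c*2 =
  subst (⌈ m /2⌉ ≤_) (sym (n≡⌈n+n/2⌉ c)) (⌈n/2⌉-mono (subst (m ≤_) c*2≡c+c m≤c*2))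
  where
  c*2≡c+c : c * 2 ≡ c + c
  c*2≡c+c = trans (*-comm c 2) (cong (c +_) (+-identityʳ c))

three-pairwise-opposite : ∀ {p q r : Parity} → p ≡ q ⁻¹ → q ≡ r ⁻¹ → p ≡ r ⁻¹ → ⊥
three-pairwise-opposite {p} {q} {r} p≡q⁻¹ q≡r⁻¹ p≡r⁻¹ =
  p≢p⁻¹ r (trans (sym q≡r) q≡r⁻¹)
  where
  q≡r : q ≡ r
  q≡r = ⁻¹-injective (trans (sym p≡q⁻¹) p≡r⁻¹)

inner : ∀ {a} → Fin a → Fin (suc (suc a))
inner = suc ∘ inject₁

toℕ-inner : ∀ {a} (i : Fin a) → toℕ (inner i) ≡ suc (toℕ i)
toℕ-inner i = cong suc (toℕ-inject₁ i)

interior : ∀ a b → Fin (a * b) → Fin (suc (suc a) * suc (suc b))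
interior a b w = combine (inner (proj₁ (remQuot {a} b w))) (inner (proj₂ (remQuot {a} b w)))

interior-injective : ∀ a b {v w} → interior a b v ≡ interior a b w → v ≡ w
interior-injective a b {v} {w} eq
  with combine-injective (inner (proj₁ (remQuot {a} b v))) (inner (proj₂ (remQuot {a} b v)))
                         (inner (proj₁ (remQuot {a} b w))) (inner (proj₂ (remQuot {a} b w))) eq
... | i≡i' , j≡j' = begin
  v
    ≡⟨ combine-remQuot {a} b v ⟨
  combine (proj₁ (remQuot {a} b v)) (proj₂ (remQuot {a} b v))
    ≡⟨ cong₂ combine (inner-injective i≡i') (inner-injective j≡j') ⟩
  combine (proj₁ (remQuot {a} b w)) (proj₂ (remQuot {a} b w))
    ≡⟨ combine-remQuot {a} b w ⟩
  w
    ∎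
  where
  open ≡-Reasoning
  inner-injective : ∀ {m} {i j : Fin m} → inner i ≡ inner j → i ≡ j
  inner-injective = inject₁-injective ∘ suc-injective

interior-degree : ∀ a b w → deg (P (suc (suc a)) □ P (suc (suc b))) (interior a b w) ≡ 4
interior-degree a b w = begin
  deg (P (suc (suc a)) □ P (suc (suc b))) (combine (inner i) (inner j))
    ≡⟨ grid-deg-combine (inner i) (inner j) ⟩
  pathDegree (suc (suc b)) (toℕ (inner j)) + pathDegree (suc (suc a)) (toℕ (inner i))
    ≡⟨ cong₂ (λ y x → pathDegree (suc (suc b)) y + pathDegree (suc (suc a)) x) (toℕ-inner j) (toℕ-inner i) ⟩
  pathDegree (suc (suc b)) (suc (toℕ j)) + pathDegree (suc (suc a)) (suc (toℕ i))
    ≡⟨ cong₂ _+_ (pathDegree-inner (toℕ<n j)) (pathDegree-inner (toℕ<n i)) ⟩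
  4 ∎
  where
  open ≡-Reasoning
  i = proj₁ (remQuot {a} b w)
  j = proj₂ (remQuot {a} b w)

δ-lower-bound : ∀ a b c → Colorable (δ-complement (P (suc (suc a)) □ P (suc (suc b)))) c → ⌈ a * b /2⌉ ≤ c
δ-lower-bound a b c (f , proper) = ⌈/2⌉-≤ (noMonochromaticTriple⇒≤*2 (f ∘ interior a b) no-triple)
  where
  x y : Fin (a * b) → ℕ
  x w = toℕ (inner (proj₁ (remQuot {a} b w)))
  y w = toℕ (inner (proj₂ (remQuot {a} b w)))

  opposite : ∀ {v w} → v ≢ w → f (interior a b v) ≡ f (interior a b w) →
             parity (x v + y v) ≡ parity (x w + y w) ⁻¹
  opposite {v} {w} v≢w same-colour =
    gridAdj⇒opposite-parity (x v) (y v) (x w) (y w)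
      (trans (sym (grid-combine (inner (proj₁ (remQuot {a} b v))) (inner (proj₁ (remQuot {a} b w)))
                                (inner (proj₂ (remQuot {a} b v))) (inner (proj₂ (remQuot {a} b w)))))
             (monochromatic⇒adjacent (P (suc (suc a)) □ P (suc (suc b))) f proper (v≢w ∘ interior-injective a b)
               (trans (interior-degree a b v) (sym (interior-degree a b w))) same-colour))

  no-triple : ∀ {u v w} → u Fin.< v → v Fin.< w →
              f (interior a b u) ≡ f (interior a b v) → f (interior a b v) ≡ f (interior a b w) → ⊥
  no-triple u<v v<w e₁ e₂ =
    three-pairwise-opposite (opposite (<⇒≢ u<v) e₁) (opposite (<⇒≢ v<w) e₂)
                            (opposite (<⇒≢ (<-transFin u<v v<w)) (trans e₁ e₂))

-- Upper bound

⌊n/2⌋+⌊n/2⌋≤n : ∀ n → ⌊ n /2⌋ + ⌊ n /2⌋ ≤ n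
⌊n/2⌋+⌊n/2⌋≤n n =
  subst (⌊ n /2⌋ + ⌊ n /2⌋ ≤_) (⌊n/2⌋+⌈n/2⌉≡n n) (+-monoʳ-≤ ⌊ n /2⌋ (⌊n/2⌋≤⌈n/2⌉ n))

n≤1+⌊n/2⌋+⌊n/2⌋ : ∀ n → n ≤ suc (⌊ n /2⌋ + ⌊ n /2⌋)
n≤1+⌊n/2⌋+⌊n/2⌋ n = subst₂ _≤_ (⌊n/2⌋+⌈n/2⌉≡n n) (+-suc ⌊ n /2⌋ ⌊ n /2⌋)
                            (+-monoʳ-≤ ⌊ n /2⌋ (⌊n/2⌋-mono (n≤1+n (suc n))))

⌊m/2⌋<n : ∀ {m n} → m < n + n → ⌊ m /2⌋ < n
⌊m/2⌋<n {m} {n} m<n+n = subst (suc ⌊ m /2⌋ ≤_) (sym (n≡⌈n+n/2⌉ n)) (⌈n/2⌉-mono m<n+n)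

m+m≤n⇒m≤⌈n/2⌉ : ∀ {m n} → m + m ≤ n → m ≤ ⌈ n /2⌉
m+m≤n⇒m≤⌈n/2⌉ {m} {n} m+m≤n = subst (_≤ ⌈ n /2⌉) (sym (n≡⌈n+n/2⌉ m)) (⌈n/2⌉-mono m+m≤n)

m+m<n⇒m<⌈n/2⌉ : ∀ {m n} → m + m < n → m < ⌈ n /2⌉
m+m<n⇒m<⌈n/2⌉ {m} {n} m+m<n = subst (_≤ ⌈ n /2⌉) (cong suc (sym (n≡⌊n+n/2⌋ m))) (⌈n/2⌉-mono m+m<n)

encode-injective : ∀ {b} .{{_ : NonZero b}} {q q' r r'} → r < b → r' < b →
                   q * b + r ≡ q' * b + r' → (q , r) ≡ (q' , r')
encode-injective {b} {q} {q'} {r} {r'} r<b r'<b eq = cong₂ _,_ q≡q' r≡r'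
  where
  open ≡-Reasoning
  r≡r' : r ≡ r'
  r≡r' = begin
    r                  ≡⟨ m<n⇒m%n≡m r<b ⟨
    r % b              ≡⟨ [m+kn]%n≡m%n r q b ⟨
    (r + q * b) % b    ≡⟨ cong (_% b) (trans (+-comm r (q * b)) (trans eq (+-comm (q' * b) r'))) ⟩
    (r' + q' * b) % b  ≡⟨ [m+kn]%n≡m%n r' q' b ⟩
    r' % b             ≡⟨ m<n⇒m%n≡m r'<b ⟩
    r'                 ∎
  q≡q' : q ≡ q'
  q≡q' = *-cancelʳ-≡ q q' b (+-cancelʳ-≡ r (q * b) (q' * b) (trans eq (cong (q' * b +_) (sym r≡r'))))

-- a = n - 2 and b = k - 2 are written as 4 + _ so that comparisons with small constants compute.
module Colouring (a′ b′ : ℕ) where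

  a b R C : ℕ
  a = 4 + a′
  b = 4 + b′
  R = ⌊ a /2⌋
  C = ⌈ a * b /2⌉

  -- Rows are x = 0, …, a + 1. Row p + 1 with p < R + R lies in the row pair ⌊ p /2⌋; when a is
  -- odd, the inner row a = R + R + 1 is left unpaired.
  data RowType : ℕ → Set where
    top    : RowType 0
    bottom : RowType (suc a)
    paired : ∀ p → p < R + R → RowType (suc p)
    last   : a ≡ suc (R + R) → RowType (suc (R + R))

  data ColType : ℕ → Set where
    left  : ColType 0
    right : ColType (suc b)
    mid   : ∀ t → t < b → ColType (suc t)

  R+R≤a : R + R ≤ a
  R+R≤a = ⌊n/2⌋+⌊n/2⌋≤n a

  paired<a : ∀ {p} → p < R + R → p < a
  paired<a p<2R = <-≤-trans p<2R R+R≤a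

  rowType : ∀ x → x < suc (suc a) → RowType x
  rowType zero    _         = top
  rowType (suc p) (s≤s (s≤s p≤a)) with p <ℕ? R + R | p ≟ℕ a
  ... | yes p<2R | _        = paired p p<2R
  ... | no  _    | yes refl = bottom
  ... | no  p≮2R | no  p≢a  = subst RowType (cong suc (sym p≡2R)) (last a≡1+2R)
    where
    p<a : p < a
    p<a = ≤∧≢⇒< p≤a p≢a
    p≡2R : p ≡ R + R
    p≡2R = ≤-antisym (≤-pred (≤-trans p<a (n≤1+⌊n/2⌋+⌊n/2⌋ a))) (≮⇒≥ p≮2R)
    a≡1+2R : a ≡ suc (R + R)
    a≡1+2R = ≤-antisym (n≤1+⌊n/2⌋+⌊n/2⌋ a) (subst (λ z → suc z ≤ a) p≡2R p<a)

  colType : ∀ y → y < suc (suc b) → ColType y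
  colType zero    _         = left
  colType (suc t) (s≤s (s≤s t≤b)) with t ≟ℕ b
  ... | yes refl = right
  ... | no  t≢b  = mid t (≤∧≢⇒< t≤b t≢b)

  rowDegree : ∀ {x} → RowType x → ℕ
  rowDegree top          = 1
  rowDegree bottom       = 1
  rowDegree (paired _ _) = 2
  rowDegree (last _)     = 2

  colDegree : ∀ {y} → ColType y → ℕ
  colDegree left      = 1
  colDegree right     = 1
  colDegree (mid _ _) = 2

  rowDegree-correct : ∀ {x} (r : RowType x) → pathDegree (suc (suc a)) x ≡ rowDegree r
  rowDegree-correct top             = refl
  rowDegree-correct bottom          = pathDegree-end a
  rowDegree-correct (paired p p<2R) = pathDegree-inner (paired<a p<2R)
  rowDegree-correct (last a≡1+2R)   = pathDegree-inner (subst (R + R <_) (sym a≡1+2R) ≤-refl)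

  colDegree-correct : ∀ {y} (c : ColType y) → pathDegree (suc (suc b)) y ≡ colDegree c
  colDegree-correct left        = refl
  colDegree-correct right       = pathDegree-end b
  colDegree-correct (mid t t<b) = pathDegree-inner t<b

  -- Colour (q , s) with q < R is the vertical domino in column s + 1 of rows 2q + 1 and 2q + 2, and
  -- (R , s) the horizontal domino in columns 2s + 1 and 2s + 2 of the unpaired row. The top and
  -- bottom rows join dominoes in rows 2R - 1, 2R and 1, 2, the side columns join columns b and
  -- b - 1, and each corner joins a domino it does not touch.
  colour : ∀ {x y} → RowType x → ColType y → ℕ × ℕ
  colour top          left      = 0 , 0
  colour top          right     = 0 , 1
  colour top          (mid t _) = pred R , ⌊ t /2⌋
  colour bottom       left      = pred R , 0
  colour bottom       right     = pred R , 1
  colour bottom       (mid t _) = 0 , ⌊ t /2⌋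
  colour (paired p _) left      = ⌊ p /2⌋ , b ∸ 1
  colour (paired p _) right     = ⌊ p /2⌋ , b ∸ 2
  colour (paired p _) (mid t _) = ⌊ p /2⌋ , t
  colour (last _)     left      = R , 1
  colour (last _)     right     = R , 0
  colour (last _)     (mid t _) = R , ⌊ t /2⌋

  isLast : ∀ {x} → RowType x → Bool
  isLast (last _) = true
  isLast _        = false

  colour-fst<R : ∀ {x y} (r : RowType x) (c : ColType y) → isLast r ≡ false → proj₁ (colour r c) < R
  colour-fst<R top             left      _ = s≤s z≤n
  colour-fst<R top             right     _ = s≤s z≤n
  colour-fst<R top             (mid _ _) _ = ≤-refl
  colour-fst<R bottom          left      _ = ≤-refl
  colour-fst<R bottom          right     _ = ≤-refl
  colour-fst<R bottom          (mid _ _) _ = s≤s z≤n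
  colour-fst<R (paired p p<2R) left      _ = ⌊m/2⌋<n p<2R
  colour-fst<R (paired p p<2R) right     _ = ⌊m/2⌋<n p<2R
  colour-fst<R (paired p p<2R) (mid _ _) _ = ⌊m/2⌋<n p<2R

  lastColour-fst : ∀ {y} e (c : ColType y) → proj₁ (colour (last e) c) ≡ R
  lastColour-fst _ left      = refl
  lastColour-fst _ right     = refl
  lastColour-fst _ (mid _ _) = refl

  ⌊t/2⌋<b : ∀ {t} → t < b → ⌊ t /2⌋ < b
  ⌊t/2⌋<b {t} = ≤-<-trans (⌊n/2⌋≤n t)

  colour-snd<b : ∀ {x y} (r : RowType x) (c : ColType y) → proj₂ (colour r c) < b
  colour-snd<b top          left        = s≤s z≤n
  colour-snd<b top          right       = s≤s (s≤s z≤n)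
  colour-snd<b top          (mid _ t<b) = ⌊t/2⌋<b t<b
  colour-snd<b bottom       left        = s≤s z≤n
  colour-snd<b bottom       right       = s≤s (s≤s z≤n)
  colour-snd<b bottom       (mid _ t<b) = ⌊t/2⌋<b t<b
  colour-snd<b (paired _ _) left        = ≤-refl
  colour-snd<b (paired _ _) right       = m<n⇒m<1+n ≤-refl
  colour-snd<b (paired _ _) (mid _ t<b) = t<b
  colour-snd<b (last _)     left        = s≤s (s≤s z≤n)
  colour-snd<b (last _)     right       = s≤s z≤n
  colour-snd<b (last _)     (mid _ t<b) = ⌊t/2⌋<b t<b

  encode : ℕ × ℕ → ℕ
  encode (q , s) = q * b + s

  R*b≤C : R * b ≤ C
  R*b≤C = m+m≤n⇒m≤⌈n/2⌉ (subst (_≤ a * b) (*-distribʳ-+ b R R) (*-monoˡ-≤ b R+R≤a))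

  nonLast-bound : ∀ {q s} → q < R → s < b → encode (q , s) < C
  nonLast-bound {q} {s} q<R s<b = begin-strict
    q * b + s   <⟨ +-monoʳ-< (q * b) s<b ⟩
    q * b + b   ≡⟨ +-comm (q * b) b ⟩
    suc q * b   ≤⟨ *-monoˡ-≤ b q<R ⟩
    R * b       ≤⟨ R*b≤C ⟩
    C           ∎
    where open ≤-Reasoning

  last-bound : ∀ {s} → a ≡ suc (R + R) → s + s < b → encode (R , s) < C
  last-bound {s} a≡1+2R s+s<b = m+m<n⇒m<⌈n/2⌉ (begin-strict
    (R * b + s) + (R * b + s)   ≡⟨ interchange (R * b) s (R * b) s ⟩
    (R * b + R * b) + (s + s)   <⟨ +-monoʳ-< (R * b + R * b) s+s<b ⟩
    (R * b + R * b) + b         ≡⟨ cong (_+ b) (*-distribʳ-+ b R R) ⟨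
    (R + R) * b + b             ≡⟨ +-comm ((R + R) * b) b ⟩
    suc (R + R) * b             ≡⟨ cong (_* b) a≡1+2R ⟨
    a * b                       ∎)
    where open ≤-Reasoning

  lastColour-snd+snd<b : ∀ {y} e (c : ColType y) → let s = proj₂ (colour (last e) c) in s + s < b
  lastColour-snd+snd<b _ left        = s≤s (s≤s (s≤s z≤n))
  lastColour-snd+snd<b _ right       = s≤s z≤n
  lastColour-snd+snd<b _ (mid t t<b) = ≤-<-trans (⌊n/2⌋+⌊n/2⌋≤n t) t<b

  colour-bound : ∀ {x y} (r : RowType x) (c : ColType y) → encode (colour r c) < C
  colour-bound (last e) c =
    subst (λ q → q * b + proj₂ (colour (last e) c) < C) (sym (lastColour-fst e c))
          (last-bound e (lastColour-snd+snd<b e c))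
  colour-bound top          c = nonLast-bound (colour-fst<R top c refl) (colour-snd<b top c)
  colour-bound bottom       c = nonLast-bound (colour-fst<R bottom c refl) (colour-snd<b bottom c)
  colour-bound (paired p l) c = nonLast-bound (colour-fst<R (paired p l) c refl) (colour-snd<b (paired p l) c)

  Compatible : ∀ {x y x' y'} → RowType x → ColType y → RowType x' → ColType y' → Set
  Compatible {x} {y} {x'} {y'} r c r' c' =
    δ-edge (colDegree c + rowDegree r) (colDegree c' + rowDegree r') (gridAdj x y x' y') ≡ false

  SameColour⇒Compatible : ∀ {x x'} → RowType x → RowType x' → Set
  SameColour⇒Compatible {x} {x'} r r' = ∀ {y y'} (c : ColType y) (c' : ColType y') →
    proj₁ (colour r c) ≡ proj₁ (colour r' c') → proj₂ (colour r c) ≡ proj₂ (colour r' c') →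
    (x , y) ≢ (x' , y') → Compatible r c r' c'

  flip-compatible : ∀ {x x'} (r : RowType x) (r' : RowType x') →
                    SameColour⇒Compatible r r' → SameColour⇒Compatible r' r
  flip-compatible {x} {x'} r r' compatible {y} {y'} c c' e₁ e₂ distinct =
    trans (δ-edge-sym (colDegree c + rowDegree r') (colDegree c' + rowDegree r) (gridAdj x' y x y'))
          (trans (cong (δ-edge (colDegree c' + rowDegree r) (colDegree c + rowDegree r')) (gridAdj-sym x' y x y'))
                 (compatible c' c (sym e₁) (sym e₂) (distinct ∘ sym)))

  ⌊t/2⌋<b∸2 : ∀ {t} → t < b → ⌊ t /2⌋ < b ∸ 2
  ⌊t/2⌋<b∸2 t<b = ⌊m/2⌋<n (≤-trans t<b (s≤s (s≤s (m≤n+m (suc (suc b′)) b′))))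

  sameHalf⇒column-step : ∀ {x t t' : ℕ} → (x , suc t) ≢ (x , suc t') → ⌊ t /2⌋ ≡ ⌊ t' /2⌋ →
                         dist1 t t' ≡ true
  sameHalf⇒column-step {x} {t} {t'} distinct e = ⌊/2⌋-≡⇒dist1 t t' e (distinct ∘ cong (λ s → x ,′ suc s))

  sameHalf⇒row-step : ∀ {p p'} (y : ℕ) → (suc p , y) ≢ (suc p' , y) → ⌊ p /2⌋ ≡ ⌊ p' /2⌋ →
                      dist1 p p' ≡ true
  sameHalf⇒row-step {p} {p'} y distinct e = ⌊/2⌋-≡⇒dist1 p p' e (distinct ∘ cong (λ s → suc s ,′ y))

  top-top : SameColour⇒Compatible top top
  top-top left      left       _  _  distinct = ⊥-elim (distinct refl)
  top-top left      right      _  () _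
  top-top left      (mid _ _)  () _  _
  top-top right     left       _  () _
  top-top right     right      _  _  distinct = ⊥-elim (distinct refl)
  top-top right     (mid _ _)  () _  _
  top-top (mid _ _) left       () _  _
  top-top (mid _ _) right      () _  _
  top-top (mid t _) (mid t' _) _  e₂ distinct =
    cong not (gridAdj-row 0 (suc t) (suc t') (sameHalf⇒column-step distinct e₂))

  bottom-bottom : SameColour⇒Compatible bottom bottom
  bottom-bottom left      left       _  _  distinct = ⊥-elim (distinct refl)
  bottom-bottom left      right      _  () _
  bottom-bottom left      (mid _ _)  () _  _
  bottom-bottom right     left       _  () _
  bottom-bottom right     right      _  _  distinct = ⊥-elim (distinct refl)
  bottom-bottom right     (mid _ _)  () _  _
  bottom-bottom (mid _ _) left       () _  _
  bottom-bottom (mid _ _) right      () _  _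
  bottom-bottom (mid t _) (mid t' _) _  e₂ distinct =
    cong not (gridAdj-row (suc a) (suc t) (suc t') (sameHalf⇒column-step distinct e₂))

  top-bottom : SameColour⇒Compatible top bottom
  top-bottom left      left      () _ _
  top-bottom left      right     () _ _
  top-bottom left      (mid _ _) _  _ _ = refl
  top-bottom right     left      () _ _
  top-bottom right     right     () _ _
  top-bottom right     (mid _ _) _  _ _ = refl
  top-bottom (mid _ _) left      _  _ _ = refl
  top-bottom (mid _ _) right     _  _ _ = refl
  top-bottom (mid _ _) (mid _ _) () _ _

  top-paired : ∀ {p} (p<2R : p < R + R) → SameColour⇒Compatible top (paired p p<2R)
  top-paired _ left        left         _  () _
  top-paired _ left        right        _  () _
  top-paired {p} _ left  (mid t' _)   _  _  _ = gridAdj-false 0 0 (suc p) (suc t') (inj₁ refl) (inj₂ refl)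
  top-paired _ right       left         _  () _
  top-paired _ right       right        _  () _
  top-paired {p} _ right (mid t' t'<b) _ _ _ =
    gridAdj-false 0 (suc b) (suc p) (suc t') (inj₁ refl) (inj₂ (≢⇒≡ᵇ-false (>⇒≢ t'<b)))
  top-paired _ (mid _ t<b) left         _  e₂ _ = ⊥-elim (<-irrefl e₂ (m<n⇒m<1+n (⌊t/2⌋<b∸2 t<b)))
  top-paired _ (mid _ t<b) right        _  e₂ _ = ⊥-elim (<-irrefl e₂ (⌊t/2⌋<b∸2 t<b))
  top-paired {zero}        _ (mid _ _) (mid _ _) () _ _
  top-paired {suc zero}    _ (mid _ _) (mid _ _) () _ _
  top-paired {suc (suc _)} _ (mid _ _) (mid _ _) _  _ _ = refl

  bottom-paired : ∀ {p} (p<2R : p < R + R) → SameColour⇒Compatible bottom (paired p p<2R)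
  bottom-paired _ left left  _ () _
  bottom-paired _ left right _ () _
  bottom-paired {p} p<2R left (mid t' _) _ _ _ =
    gridAdj-false (suc a) 0 (suc p) (suc t') (inj₁ (≢⇒≡ᵇ-false (>⇒≢ (paired<a p<2R)))) (inj₂ refl)
  bottom-paired _ right left  _ () _
  bottom-paired _ right right _ () _
  bottom-paired {p} p<2R right (mid t' t'<b) _ _ _ =
    gridAdj-false (suc a) (suc b) (suc p) (suc t') (inj₁ (≢⇒≡ᵇ-false (>⇒≢ (paired<a p<2R))))
                                                   (inj₂ (≢⇒≡ᵇ-false (>⇒≢ t'<b)))
  bottom-paired _ (mid _ t<b) left  _ e₂ _ = ⊥-elim (<-irrefl e₂ (m<n⇒m<1+n (⌊t/2⌋<b∸2 t<b)))
  bottom-paired _ (mid _ t<b) right _ e₂ _ = ⊥-elim (<-irrefl e₂ (⌊t/2⌋<b∸2 t<b))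
  bottom-paired {zero}        _ (mid _ _) (mid _ _) _  _ _ = refl
  bottom-paired {suc zero}    _ (mid _ _) (mid _ _) _  _ _ = refl
  bottom-paired {suc (suc _)} _ (mid _ _) (mid _ _) () _ _

  paired-paired : ∀ {p p'} (p<2R : p < R + R) (p'<2R : p' < R + R) →
                  SameColour⇒Compatible (paired p p<2R) (paired p' p'<2R)
  paired-paired {p} {p'} _ _ left left e₁ _ distinct =
    cong not (gridAdj-column (suc p) (suc p') 0 (sameHalf⇒row-step 0 distinct e₁))
  paired-paired _ _ left right _ () _
  paired-paired {p} {p'} _ _ left (mid _ _) _ refl _ =
    gridAdj-false (suc p) 0 (suc p') b (inj₂ refl) (inj₂ refl)
  paired-paired _ _ right left _ () _
  paired-paired {p} {p'} _ _ right right e₁ _ distinct =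
    cong not (gridAdj-column (suc p) (suc p') (suc b) (sameHalf⇒row-step (suc b) distinct e₁))
  paired-paired {p} {p'} _ _ right (mid _ _) _ refl _ =
    gridAdj-false (suc p) (suc b) (suc p') (b ∸ 1) (inj₂ (dist1-+2 (b ∸ 1))) (inj₂ (≡ᵇ-+2 (b ∸ 1)))
  paired-paired {p} {p'} _ _ (mid _ _) left _ refl _ =
    gridAdj-false (suc p) b (suc p') 0 (inj₂ refl) (inj₂ refl)
  paired-paired {p} {p'} _ _ (mid _ _) right _ refl _ =
    gridAdj-false (suc p) (b ∸ 1) (suc p') (suc b)
                  (inj₂ (trans (dist1-sym (b ∸ 1) (suc b)) (dist1-+2 (b ∸ 1))))
                  (inj₂ (trans (≡ᵇ-sym (b ∸ 1) (suc b)) (≡ᵇ-+2 (b ∸ 1))))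
  paired-paired {p} {p'} _ _ (mid t _) (mid _ _) e₁ refl distinct =
    cong not (gridAdj-column (suc p) (suc p') (suc t) (sameHalf⇒row-step (suc t) distinct e₁))

  last-last : ∀ e e' → SameColour⇒Compatible (last e) (last e')
  last-last _ _ left      left      _ _  distinct = ⊥-elim (distinct refl)
  last-last _ _ left      right     _ () _
  last-last _ _ left      (mid zero _)          _ () _
  last-last _ _ left      (mid (suc zero) _)    _ () _
  last-last _ _ left      (mid (suc (suc t')) _) _ _ _ =
    gridAdj-false (suc (R + R)) 0 (suc (R + R)) (suc (suc (suc t'))) (inj₂ refl) (inj₂ refl)
  last-last _ _ right     left      _ () _
  last-last _ _ right     right     _ _  distinct = ⊥-elim (distinct refl)
  last-last _ _ right     (mid zero _)          _ _ _ =
    gridAdj-false (suc (R + R)) (suc b) (suc (R + R)) 1 (inj₂ refl) (inj₂ refl)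
  last-last _ _ right     (mid (suc zero) _)    _ _ _ =
    gridAdj-false (suc (R + R)) (suc b) (suc (R + R)) 2 (inj₂ refl) (inj₂ refl)
  last-last _ _ right     (mid (suc (suc _)) _) _ () _
  last-last _ _ (mid zero _)          left _ () _
  last-last _ _ (mid (suc zero) _)    left _ () _
  last-last _ _ (mid (suc (suc t)) _) left _ _ _ =
    gridAdj-false (suc (R + R)) (suc (suc (suc t))) (suc (R + R)) 0 (inj₂ refl) (inj₂ refl)
  last-last _ _ (mid zero _)          right _ _ _ =
    gridAdj-false (suc (R + R)) 1 (suc (R + R)) (suc b) (inj₂ refl) (inj₂ refl)
  last-last _ _ (mid (suc zero) _)    right _ _ _ =
    gridAdj-false (suc (R + R)) 2 (suc (R + R)) (suc b) (inj₂ refl) (inj₂ refl)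
  last-last _ _ (mid (suc (suc _)) _) right _ () _
  last-last _ _ (mid t _) (mid t' _) _ e₂ distinct =
    cong not (gridAdj-row (suc (R + R)) (suc t) (suc t') (sameHalf⇒column-step distinct e₂))

  last-nonLast : ∀ {x'} e (r' : RowType x') → isLast r' ≡ false → SameColour⇒Compatible (last e) r'
  last-nonLast e r' nonLast c c' e₁ _ _ =
    ⊥-elim (<-irrefl (sym (trans (sym (lastColour-fst e c)) e₁)) (colour-fst<R r' c' nonLast))

  sameColour⇒compatible : ∀ {x x'} (r : RowType x) (r' : RowType x') → SameColour⇒Compatible r r'
  sameColour⇒compatible top          top          = top-top
  sameColour⇒compatible top          bottom       = top-bottom
  sameColour⇒compatible top          (paired _ l) = top-paired l
  sameColour⇒compatible bottom       top          = flip-compatible top bottom top-bottom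
  sameColour⇒compatible bottom       bottom       = bottom-bottom
  sameColour⇒compatible bottom       (paired _ l) = bottom-paired l
  sameColour⇒compatible (paired _ l) top          = flip-compatible top (paired _ l) (top-paired l)
  sameColour⇒compatible (paired _ l) bottom       = flip-compatible bottom (paired _ l) (bottom-paired l)
  sameColour⇒compatible (paired _ l) (paired _ m) = paired-paired l m
  sameColour⇒compatible (last e)     (last e')    = last-last e e'
  sameColour⇒compatible (last e)     top          = last-nonLast e top refl
  sameColour⇒compatible (last e)     bottom       = last-nonLast e bottom refl
  sameColour⇒compatible (last e)     (paired p l) = last-nonLast e (paired p l) refl
  sameColour⇒compatible top          (last e)     = flip-compatible (last e) top (last-nonLast e top refl)
  sameColour⇒compatible bottom       (last e)     = flip-compatible (last e) bottom (last-nonLast e bottom refl)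
  sameColour⇒compatible (paired p l) (last e)     =
    flip-compatible (last e) (paired p l) (last-nonLast e (paired p l) refl)
  open GridCoordinates (suc (suc a)) (suc (suc b))

  G : Graph (suc (suc a) * suc (suc b))
  G = P (suc (suc a)) □ P (suc (suc b))

  rowTypeOf : ∀ u → RowType (row u)
  rowTypeOf u = rowType (row u) (toℕ<n _)

  colTypeOf : ∀ u → ColType (col u)
  colTypeOf u = colType (col u) (toℕ<n _)

  colourOf : Fin (suc (suc a) * suc (suc b)) → ℕ × ℕ
  colourOf u = colour (rowTypeOf u) (colTypeOf u)

  degreeOf : Fin (suc (suc a) * suc (suc b)) → ℕ
  degreeOf u = colDegree (colTypeOf u) + rowDegree (rowTypeOf u)

  deg≡degreeOf : ∀ u → deg G u ≡ degreeOf u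
  deg≡degreeOf u =
    trans (grid-deg u) (cong₂ _+_ (colDegree-correct (colTypeOf u)) (rowDegree-correct (rowTypeOf u)))

  sameColour⇒δ-nonadjacent : ∀ u v → colourOf u ≡ colourOf v → δ-complement G u v ≡ false
  sameColour⇒δ-nonadjacent u v same = by-cases (u ≟ v)
    where
    by-cases : Dec (u ≡ v) → δ-complement G u v ≡ false
    by-cases (yes refl) = δ-complement-irrefl G u
    by-cases (no u≢v)   = begin
      δ-complement G u v
        ≡⟨ δ-complement-≢ G u≢v ⟩
      δ-edge (deg G u) (deg G v) (G u v)
        ≡⟨ cong₂ (λ d d' → δ-edge d d' (G u v)) (deg≡degreeOf u) (deg≡degreeOf v) ⟩
      δ-edge (degreeOf u) (degreeOf v) (G u v)
        ≡⟨ cong (δ-edge (degreeOf u) (degreeOf v)) (grid-adj u v) ⟩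
      δ-edge (degreeOf u) (degreeOf v) (gridAdj (row u) (col u) (row v) (col v))
        ≡⟨ sameColour⇒compatible (rowTypeOf u) (rowTypeOf v) (colTypeOf u) (colTypeOf v)
                                 (cong proj₁ same) (cong proj₂ same) (u≢v ∘ coordinates-injective) ⟩
      false
        ∎
      where open ≡-Reasoning

  colourable : Colorable (δ-complement G) C
  colourable = f , proper
    where
    f : Fin (suc (suc a) * suc (suc b)) → Fin C
    f u = fromℕ< (colour-bound (rowTypeOf u) (colTypeOf u))

    proper : ∀ u v → δ-complement G u v ≡ true → f u ≢ f v
    proper u v δuv fu≡fv = true≢false (trans (sym δuv) (sameColour⇒δ-nonadjacent u v same-colour))
      where
      same-code : encode (colourOf u) ≡ encode (colourOf v)
      same-code = trans (sym (toℕ-fromℕ< _)) (trans (cong toℕ fu≡fv) (toℕ-fromℕ< _))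
      same-colour : colourOf u ≡ colourOf v
      same-colour = encode-injective (colour-snd<b (rowTypeOf u) (colTypeOf u))
                                     (colour-snd<b (rowTypeOf v) (colTypeOf v)) same-code
      true≢false : true ≢ false
      true≢false ()

δ-chromatic-grid : ∀ a′ b′ → IsδChromaticNumber (P (6 + a′) □ P (6 + b′)) ⌈ (4 + a′) * (4 + b′) /2⌉
δ-chromatic-grid a′ b′ = Colouring.colourable a′ b′ , δ-lower-bound (4 + a′) (4 + b′)

mainTheorem14 : (n k : ℕ) → 6 ≤ n → n ≤ k →
    IsδChromaticNumber (P n □ P k) ⌈ (n ∸ 2) * (k ∸ 2) /2⌉
mainTheorem14 _ _ (s≤s (s≤s (s≤s (s≤s (s≤s (s≤s (z≤n {a′})))))))
                  (s≤s (s≤s (s≤s (s≤s (s≤s (s≤s {n = b′} _)))))) = δ-chromatic-grid a′ b′
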